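{- Let $\Gamma$ be a finite, connected, simple, undirected graph with at least one edge, with $n$ vertices and $m$ edges, and let $G$ be an abelian group. Then for every $G$-phase $H\in\mathcal H_\Gamma$, $$St_{l\times r}(H)=\{(f,g)\in G^n\times G^m : f_1=\cdots=f_n=g_1=\cdots=g_m\}\cong G.$$
   Context: Fix orders $V_\Gamma=\{v_1,\dots,v_n\}$, $E_\Gamma=\{e_1,\dots,e_m\}$; write $v_i\in e_j$ if $v_i$ is an endpoint of $e_j$. $\mathbb CG$ is the complex group algebra of $G$ with involution $(\sum f_x x)^*=\sum\overline{f_x}x^{ -1}$, and $M_{n\times m}(\mathbb CG)$ the $n\times m$ matrices over $\mathbb CG$ with the usual product and $(A^*)_{i,j}=(A_{j,i})^*$. A $G$-phase of $\Gamma$ is a matrix $H\in M_{n\times m}(\mathbb CG)$ with $H_{i,j}\in G$ if $v_i\in e_j$ and $H_{i,j}=0$ otherwise; $\mathcal H_\Gamma$ is the set of $G$-phases. For $g=(g_1,\dots,g_k)\in G^k$ let $\underline g=\mathrm{diag}(g_1,\dots,g_k)$. The action $l\times r$ of $G^n\times G^m$ on $\mathcal H_\Gamma$ is $((f,g),H)\mapsto \underline f^{\,*}H\underline g$, and $St_{l\times r}(H)$ is the stabilizer of $H$ under this action. -}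

module Defs where

open import Level using (Level; _⊔_)
open import Data.Nat using (ℕ; suc; _≤_)
open import Data.Fin using (Fin)
open import Data.Product using (Σ; ∃; _×_; _,_; proj₁; proj₂)
open import Data.Sum using (_⊎_)
open import Relation.Binary.PropositionalEquality using (_≡_; _≢_)
open import Algebra.Bundles using (AbelianGroup)

-- A finite simple undirected graph with vertices v_1..v_n (Fin n) and
-- edges e_1..e_m (Fin m).  Each edge is given by its two endpoints
-- (the order of the pair carries no meaning: "undirected").
record Graph (n m : ℕ) : Set where
  field
    ends     : Fin m → Fin n × Fin n
    loopless : ∀ j → proj₁ (ends j) ≢ proj₂ (ends j)
    simple   : ∀ j j' →
               (ends j ≡ ends j' ⊎ ends j ≡ (proj₂ (ends j') , proj₁ (ends j'))) →
               j ≡ j'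

  Incident : Fin n → Fin m → Set
  Incident i j = (i ≡ proj₁ (ends j)) ⊎ (i ≡ proj₂ (ends j))

  Adjacent : Fin n → Fin n → Set
  Adjacent u w = ∃ λ j → (ends j ≡ (u , w)) ⊎ (ends j ≡ (w , u))

data Reachable {n m : ℕ} (Γ : Graph n m) : Fin n → Fin n → Set where
  here : ∀ {u} → Reachable Γ u u
  step : ∀ {u w v} → Graph.Adjacent Γ u w → Reachable Γ w v → Reachable Γ u v

Connected : {n m : ℕ} → Graph n m → Set
Connected Γ = ∀ u v → Reachable Γ u v

module _ {c ℓ : Level} (G : AbelianGroup c ℓ) where
  open AbelianGroup G

  -- A G-phase of Γ: an n×m matrix whose (i,j) entry lies in G when v_i ∈ e_j
  -- and is 0 otherwise.  We store only the G-valued entries: the matrix is a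
  -- function Fin n → Fin m → G whose values at non-incident positions are
  -- ignored (they stand for the entry 0 ∈ ℂG).
  Phase : ℕ → ℕ → Set c
  Phase n m = Fin n → Fin m → Carrier

  -- the action l×r :  ((f,g),H) ↦ f̲* H g̲ ,   entry (i,j) = f_i⁻¹ H_ij g_j
  -- (at incident positions; at the other positions both sides are 0).
  act : ∀ {n m} → (Fin n → Carrier) → (Fin m → Carrier) → Phase n m → Phase n m
  act f g H i j = ((f i) ⁻¹ ∙ H i j) ∙ g j

  -- (f,g) ∈ St_{l×r}(H)  (equality of ℂG-matrices = equality of the
  -- incident entries in G, the other entries being 0 on both sides)
  InStab : ∀ {n m} → Graph n m → Phase n m →
           (Fin n → Carrier) → (Fin m → Carrier) → Set (ℓ)
  InStab Γ H f g = ∀ i j → Graph.Incident Γ i j → act f g H i j ≈ H i j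

  AllEqual : ∀ {n m} → (Fin n → Carrier) → (Fin m → Carrier) → Set ℓ
  AllEqual f g = (∀ i i' → f i ≈ f i') × (∀ j j' → g j ≈ g j') × (∀ i j → f i ≈ g j)

  diag₁ : ∀ {n} → Carrier → Fin n → Carrier
  diag₁ x _ = x

-- A pair (f, g) fixes the entry H_ij exactly when f_i = g_j, because G is abelian and
-- f_i⁻¹ H_ij g_j = H_ij (f_i⁻¹ g_j).  So (f, g) stabilizes H iff f_u = g_j for every
-- vertex u of every edge e_j; then f is constant along edges, hence on the connected
-- graph, and any edge ties the common value of f to every g_j.  The stabilizer is
-- therefore the diagonal copy of G, which is nonempty on the edge side since m ≥ 1.
module Submission where

open import Defs
open import Level using (Level)
open import Data.Nat using (ℕ; _≤_)
open import Data.Fin using (Fin; fromℕ<)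
open import Data.Product using (∃; _×_; _,_; proj₁; proj₂)
open import Data.Sum using (inj₁; inj₂)
open import Function.Bundles using (_⇔_; mk⇔; Equivalence)
open import Algebra.Bundles using (AbelianGroup)
open import Relation.Binary.Bundles using (Setoid)
open import Relation.Binary.PropositionalEquality as ≡ using (subst)

module _ {c ℓ} (S : Setoid c ℓ) {n m : ℕ} (Γ : Graph n m) where
  open Setoid S
  open Graph Γ

  EdgeRespecting : (Fin n → Carrier) → Set ℓ
  EdgeRespecting f = ∀ j → f (proj₁ (ends j)) ≈ f (proj₂ (ends j))

  module _ {f : Fin n → Carrier} (resp : EdgeRespecting f) where

    Adjacent⇒≈ : ∀ {u w} → Adjacent u w → f u ≈ f w
    Adjacent⇒≈ (j , inj₁ eq) = subst (λ p → f (proj₁ p) ≈ f (proj₂ p)) eq (resp j)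
    Adjacent⇒≈ (j , inj₂ eq) = sym (subst (λ p → f (proj₁ p) ≈ f (proj₂ p)) eq (resp j))

    Reachable⇒≈ : ∀ {u v} → Reachable Γ u v → f u ≈ f v
    Reachable⇒≈ here       = refl
    Reachable⇒≈ (step a r) = trans (Adjacent⇒≈ a) (Reachable⇒≈ r)

    Connected⇒constant : Connected Γ → ∀ u v → f u ≈ f v
    Connected⇒constant conn u v = Reachable⇒≈ (conn u v)

module _ {c ℓ} (G : AbelianGroup c ℓ) where
  open AbelianGroup G
  open import Algebra.Properties.AbelianGroup G using (∙-cancelˡ; //-rightDividesˡ)

  a⁻¹ha≈h : ∀ a h → (a ⁻¹ ∙ h) ∙ a ≈ h
  a⁻¹ha≈h a h = trans (∙-congʳ (comm (a ⁻¹) h)) (//-rightDividesˡ a h)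

  a⁻¹hb≈h⇔a≈b : ∀ a h b → (a ⁻¹ ∙ h) ∙ b ≈ h ⇔ a ≈ b
  a⁻¹hb≈h⇔a≈b a h b = mk⇔
    (λ fixes → sym (∙-cancelˡ (a ⁻¹ ∙ h) b a (trans fixes (sym (a⁻¹ha≈h a h)))))
    (λ a≈b → trans (∙-congˡ (sym a≈b)) (a⁻¹ha≈h a h))

  module _ {n m : ℕ} (Γ : Graph n m) (H : Phase G n m) where
    open Graph Γ

    InStab⇔incident-≈ : ∀ f g →
      InStab G Γ H f g ⇔ (∀ i j → Incident i j → f i ≈ g j)
    InStab⇔incident-≈ f g = mk⇔
      (λ st i j inc → Equivalence.to   (a⁻¹hb≈h⇔a≈b (f i) (H i j) (g j)) (st i j inc))
      (λ eq i j inc → Equivalence.from (a⁻¹hb≈h⇔a≈b (f i) (H i j) (g j)) (eq i j inc))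

    AllEqual⇒InStab : ∀ f g → AllEqual G f g → InStab G Γ H f g
    AllEqual⇒InStab f g (_ , _ , f≈g) = Equivalence.from (InStab⇔incident-≈ f g) (λ i j _ → f≈g i j)

    InStab⇒AllEqual : Connected Γ → ∀ f g → InStab G Γ H f g → AllEqual G f g
    InStab⇒AllEqual conn f g st = f-const , g-const , f≈g
      where
      incident-≈ : ∀ i j → Incident i j → f i ≈ g j
      incident-≈ = Equivalence.to (InStab⇔incident-≈ f g) st

      f-const : ∀ i i' → f i ≈ f i'
      f-const = Connected⇒constant setoid Γ
        (λ j → trans (incident-≈ _ j (inj₁ ≡.refl)) (sym (incident-≈ _ j (inj₂ ≡.refl)))) conn

      f≈g : ∀ i j → f i ≈ g j
      f≈g i j = trans (f-const i (proj₁ (ends j))) (incident-≈ _ j (inj₁ ≡.refl))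

      g-const : ∀ j j' → g j ≈ g j'
      g-const j j' = trans (sym (f≈g (proj₁ (ends j)) j)) (f≈g (proj₁ (ends j)) j')

proposition4p6 : {c ℓ : Level} (G : AbelianGroup c ℓ) (n m : ℕ) (Γ : Graph n m) →
    Connected Γ → 1 ≤ m → (H : Phase G n m) →
    -- St_{l×r}(H) = {(f,g) : f_1 = ⋯ = f_n = g_1 = ⋯ = g_m}
    ((f : Fin n → AbelianGroup.Carrier G) (g : Fin m → AbelianGroup.Carrier G) →
      InStab G Γ H f g ⇔ AllEqual G f g)
    -- ≅ G via the diagonal homomorphism x ↦ ((x,…,x),(x,…,x)):
    -- it lands in the stabilizer, is injective, and is onto the stabilizer
    × ((x : AbelianGroup.Carrier G) → InStab G Γ H (diag₁ G x) (diag₁ G x))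
    × ((x y : AbelianGroup.Carrier G) →
        ((i : Fin n) → AbelianGroup._≈_ G (diag₁ G x i) (diag₁ G y i)) →
        ((j : Fin m) → AbelianGroup._≈_ G (diag₁ G x j) (diag₁ G y j)) →
        AbelianGroup._≈_ G x y)
    × ((f : Fin n → AbelianGroup.Carrier G) (g : Fin m → AbelianGroup.Carrier G) →
        InStab G Γ H f g →
        ∃ λ x → ((i : Fin n) → AbelianGroup._≈_ G (f i) (diag₁ G x i))
              × ((j : Fin m) → AbelianGroup._≈_ G (g j) (diag₁ G x j)))
proposition4p6 G n m Γ conn 1≤m H =
    (λ f g → mk⇔ (InStab⇒AllEqual G Γ H conn f g) (AllEqual⇒InStab G Γ H f g))
  , (λ x → AllEqual⇒InStab G Γ H (diag₁ G x) (diag₁ G x)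
             ((λ _ _ → refl) , (λ _ _ → refl) , (λ _ _ → refl)))
  , (λ x y _ x≈y → x≈y e₀)
  , λ f g st → let (_ , g-const , f≈g) = InStab⇒AllEqual G Γ H conn f g st in
      g e₀ , (λ i → f≈g i e₀) , (λ j → g-const j e₀)
  where
  open AbelianGroup G using (refl)
  e₀ : Fin m
  e₀ = fromℕ< 1≤m
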